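{- For any hypergraph $H$ of degree $\le n$, there is a monotone hypergraph program of degree $\le\max(2,n)$ and size $2|H|$ computing the hypergraph function $f_H$.
   Context: A hypergraph $H=(V,E)$ has vertex set $V$ and hyperedges $E\subseteq 2^V$; $|H|$ is the number of hyperedges. $H$ has degree $\le n$ if every vertex belongs to at most $n$ hyperedges. A subset $X\subseteq E$ is independent if $e\cap e'=\emptyset$ for distinct $e,e'\in X$; $V_X$ is the set of vertices occurring in hyperedges of $X$. With each $v\in V$ and $e\in E$ associate propositional variables $p_v$, $p_e$; the hypergraph function is $f_H=\bigvee_{X\subseteq E\text{ independent}}\big(\bigwedge_{v\in V\setminus V_X}p_v\land\bigwedge_{e\in X}p_e\big)$. A hypergraph program (HGP) is a hypergraph in which every vertex is labelled with $0$, $1$, a variable $p_i$ or a negated variable $\neg p_i$; it computes a Boolean function $f$ if for every input assignment $\vec{\alpha}$, $f(\vec{\alpha})=1$ iff there is an independent set of hyperedges containing (covering) every vertex whose label evaluates to $0$ under $\vec{\alpha}$. It is monotone if no label is a negated variable. Its size is its number of hyperedges; its degree is defined as for hypergraphs. -}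

module Defs where

open import Data.Nat using (ℕ; _≤_)
open import Data.Bool using (Bool; true; false)
open import Data.Fin using (Fin)
open import Data.Fin.Subset using (Subset; _∈_; _∉_; ∣_∣)
open import Data.Vec using (lookup; tabulate)
open import Data.Sum using (_⊎_; inj₁; inj₂)
open import Data.Product using (Σ; ∃; ∃-syntax; _×_)
open import Relation.Nullary using (¬_)
open import Relation.Binary.PropositionalEquality using (_≡_; _≢_)
open import Function.Definitions using (Injective)
open import Function.Bundles using (_⇔_)

-- Hypergraphs: vertices Fin m, hyperedges indexed by Fin k.
-- E is a *set* of subsets of V, so distinct indices give distinct
-- hyperedges (the field `distinct`); |H| = k.

record Hypergraph : Set where
  field
    nV       : ℕ
    nE       : ℕ
    edge     : Fin nE → Subset nV
    distinct : Injective _≡_ _≡_ edge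
open Hypergraph public

size : Hypergraph → ℕ
size H = nE H

incident : (H : Hypergraph) → Fin (nV H) → Subset (nE H)
incident H v = tabulate (λ e → lookup (edge H e) v)

DegreeAtMost : Hypergraph → ℕ → Set
DegreeAtMost H d = ∀ v → ∣ incident H v ∣ ≤ d

Independent : (H : Hypergraph) → Subset (nE H) → Set
Independent H X = ∀ e e' → e ∈ X → e' ∈ X → e ≢ e' →
  ¬ (∃[ v ] (v ∈ edge H e × v ∈ edge H e'))

InVX : (H : Hypergraph) → Subset (nE H) → Fin (nV H) → Set
InVX H X v = ∃[ e ] (e ∈ X × v ∈ edge H e)

-- Hypergraph function f_H.  Its variables are p_v (inj₁ v) and p_e (inj₂ e).
-- f_H(α) = 1 iff some independent X has α(p_v)=1 for all v ∉ V_X and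
-- α(p_e)=1 for all e ∈ X.  (Given as the predicate "f_H(α) = 1".)

HVar : Hypergraph → Set
HVar H = Fin (nV H) ⊎ Fin (nE H)

fH : (H : Hypergraph) → (HVar H → Bool) → Set
fH H α = ∃[ X ] (Independent H X
                 × (∀ v → ¬ InVX H X v → α (inj₁ v) ≡ true)
                 × (∀ e → e ∈ X → α (inj₂ e) ≡ true))

data Label (Var : Set) : Set where
  const : Bool → Label Var
  var   : Var → Label Var
  neg   : Var → Label Var

evalLabel : {Var : Set} → (Var → Bool) → Label Var → Bool
evalLabel α (const b) = b
evalLabel α (var x)   = α x
evalLabel α (neg x)   with α x
... | true  = false
... | false = true

record HGP (Var : Set) : Set where
  field
    graph : Hypergraph
    label : Fin (nV graph) → Label Var
open HGP public

Monotone : {Var : Set} → HGP Var → Set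
Monotone P = ∀ v x → label P v ≢ neg x

Accepts : {Var : Set} → HGP Var → (Var → Bool) → Set
Accepts P α = ∃[ X ] (Independent (graph P) X
                × (∀ v → evalLabel α (label P v) ≡ false → InVX (graph P) X v))

Computes : {Var : Set} → HGP Var → ((Var → Bool) → Set) → Set
Computes P f = ∀ α → f α ⇔ Accepts P α

-- Every hyperedge e of H becomes e ∪ {hub e}, and a hyperedge link e = {hub e, tag e} is added,
-- where hub e is a fresh vertex labelled 0 and tag e a fresh vertex labelled p_e.  Since hub e
-- must be covered, an independent cover contains exactly one of the two hyperedges through it;
-- taking e ∪ {hub e} for e ∈ X and link e for e ∉ X matches the independent covers with the
-- independent sets X of H.  The vertices of H left uncovered are then those outside V_X, and
-- tag e is left uncovered exactly when e ∈ X, which gives f_H.  Old vertices keep their degree,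
-- hub e has degree 2 and tag e degree 1.
module Submission where

open import Defs
open import Data.Nat using (ℕ; _⊔_; _*_; zero; suc; _+_; _≤_; z≤n; s≤s)
open import Data.Nat.Properties using (+-identityʳ; ≤-trans; m≤m⊔n; m≤n⊔m; module ≤-Reasoning)
open import Data.Bool using (Bool; true; false; not)
open import Data.Bool.Properties using (not-¬)
open import Data.Empty using (⊥; ⊥-elim)
open import Data.Fin using (Fin; zero; suc; splitAt; _≟_)
open import Data.Fin.Properties using (+↔⊎; any?)
open import Data.Fin.Subset using (Subset; ∣_∣) renaming (_∈_ to _∈ₛ_)
open import Data.Fin.Subset.Properties using (_∈?_)
open import Data.Product using (∃-syntax; _×_; _,_; proj₂)
open import Data.Sum using (_⊎_; inj₁; inj₂; map₁)
open import Data.Vec using (lookup; tabulate)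
open import Data.Vec.Properties using (lookup∘tabulate; tabulate-cong; []=⇒lookup; lookup⇒[]=)
open import Function using (_∘_; _↔_; Inverse; Injection; mk⇔)
open import Function.Properties.Inverse using (↔-trans; ↔-refl; ↔-sym; ↔⇒↣)
open import Data.Sum.Function.Propositional using (_⊎-↔_)
open import Relation.Nullary using (¬_; yes; no; does; contradiction; _×-dec_)
open import Relation.Nullary.Decidable using (dec-true)
open import Relation.Binary.PropositionalEquality
  using (_≡_; _≢_; refl; sym; trans; cong; cong₂; subst; subst₂; module ≡-Reasoning)

∈-tabulate⁺ : ∀ {n} {f : Fin n → Bool} {i} → f i ≡ true → i ∈ₛ tabulate f
∈-tabulate⁺ {f = f} {i} fi = lookup⇒[]= i (tabulate f) (trans (lookup∘tabulate f i) fi)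

∈-tabulate⁻ : ∀ {n} {f : Fin n → Bool} {i} → i ∈ₛ tabulate f → f i ≡ true
∈-tabulate⁻ {f = f} {i} i∈ = trans (sym (lookup∘tabulate f i)) ([]=⇒lookup i∈)

≟-true⇒≡ : ∀ {n} (i j : Fin n) → does (i ≟ j) ≡ true → i ≡ j
≟-true⇒≡ i j p with i ≟ j
... | yes i≡j = i≡j

does-≟-refl : ∀ {n} (i : Fin n) → does (i ≟ i) ≡ true
does-≟-refl i = dec-true (i ≟ i) refl

∣tabulate-false∣ : ∀ n → ∣ tabulate {n = n} (λ _ → false) ∣ ≡ 0
∣tabulate-false∣ zero  = refl
∣tabulate-false∣ (suc n) = ∣tabulate-false∣ n

∣tabulate-≟∣ : ∀ {n} (j : Fin n) → ∣ tabulate (λ i → does (i ≟ j)) ∣ ≡ 1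
∣tabulate-≟∣ {suc n} zero    = cong suc (∣tabulate-false∣ n)
∣tabulate-≟∣ {suc n} (suc j) = ∣tabulate-≟∣ j

∣tabulate∘splitAt∣ : ∀ a {b} (f : Fin a ⊎ Fin b → Bool) →
  ∣ tabulate (f ∘ splitAt a) ∣ ≡ ∣ tabulate (f ∘ inj₁) ∣ + ∣ tabulate (f ∘ inj₂) ∣
∣tabulate∘splitAt∣ zero  f = refl
∣tabulate∘splitAt∣ (suc a) f with f (inj₁ zero)
... | true  = cong suc (∣tabulate∘splitAt∣ a (f ∘ map₁ suc))
... | false = ∣tabulate∘splitAt∣ a (f ∘ map₁ suc)

module IncidenceProgram {V E Var : Set} {m k : ℕ} (vertices : Fin m ↔ V) (edges : Fin k ↔ E)
  (_∋_ : E → V → Bool) (∋-injective : ∀ {x y} → (∀ c → x ∋ c ≡ y ∋ c) → x ≡ y)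
  (ℓ : V → Label Var) where

  open Inverse vertices public using () renaming
    (to to toV; from to fromV; strictlyInverseˡ to toV∘fromV; strictlyInverseʳ to fromV∘toV)
  open Inverse edges public using () renaming
    (to to toE; from to fromE; strictlyInverseˡ to toE∘fromE; strictlyInverseʳ to fromE∘toE)

  toE-injective : ∀ {j j'} → toE j ≡ toE j' → j ≡ j'
  toE-injective = Injection.injective (↔⇒↣ edges)

  fromE-injective : ∀ {x y} → fromE x ≡ fromE y → x ≡ y
  fromE-injective = Injection.injective (↔⇒↣ (↔-sym edges))

  incidence : Fin k → Subset m
  incidence j = tabulate (λ i → toE j ∋ toV i)

  ∈-incidence⁺ : ∀ {x c} → x ∋ c ≡ true → fromV c ∈ₛ incidence (fromE x)
  ∈-incidence⁺ {x} {c} =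
    ∈-tabulate⁺ ∘ subst₂ (λ y d → y ∋ d ≡ true) (sym (toE∘fromE x)) (sym (toV∘fromV c))

  incidence-injective : ∀ {j j'} → incidence j ≡ incidence j' → j ≡ j'
  incidence-injective {j} {j'} eq = toE-injective (∋-injective same-row)
    where
    same-row : ∀ c → toE j ∋ c ≡ toE j' ∋ c
    same-row c = begin
      toE j ∋ c                          ≡⟨ cong (toE j ∋_) (toV∘fromV c) ⟨
      toE j ∋ toV (fromV c)              ≡⟨ lookup∘tabulate _ (fromV c) ⟨
      lookup (incidence j) (fromV c)     ≡⟨ cong (λ p → lookup p (fromV c)) eq ⟩
      lookup (incidence j') (fromV c)    ≡⟨ lookup∘tabulate _ (fromV c) ⟩
      toE j' ∋ toV (fromV c)             ≡⟨ cong (toE j' ∋_) (toV∘fromV c) ⟩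
      toE j' ∋ c                         ∎
      where open ≡-Reasoning

  hypergraph : Hypergraph
  hypergraph = record { nV = m ; nE = k ; edge = incidence ; distinct = incidence-injective }

  program : HGP Var
  program = record { graph = hypergraph ; label = ℓ ∘ toV }

  ∣incident∣ : ∀ i → ∣ incident hypergraph i ∣ ≡ ∣ tabulate (λ j → toE j ∋ toV i) ∣
  ∣incident∣ i = cong ∣_∣ (tabulate-cong (λ j → lookup∘tabulate (λ i → toE j ∋ toV i) i))

  PairwiseDisjoint : (E → Bool) → Set
  PairwiseDisjoint S = ∀ x y → S x ≡ true → S y ≡ true → x ≢ y →
    ∀ c → x ∋ c ≡ true → y ∋ c ≡ true → ⊥

  Covers : (E → Bool) → V → Set
  Covers S c = ∃[ x ] (S x ≡ true × x ∋ c ≡ true)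

  AcceptsBy : (Var → Bool) → (E → Bool) → Set
  AcceptsBy α S = PairwiseDisjoint S × (∀ c → evalLabel α (ℓ c) ≡ false → Covers S c)

  subsetOf : (E → Bool) → Subset k
  subsetOf S = tabulate (S ∘ toE)

  selectorOf : Subset k → E → Bool
  selectorOf Y = lookup Y ∘ fromE

  independent⁺ : ∀ {S} → PairwiseDisjoint S → Independent hypergraph (subsetOf S)
  independent⁺ disjoint j j' j∈ j'∈ j≢j' (i , i∈j , i∈j') =
    disjoint (toE j) (toE j') (∈-tabulate⁻ j∈) (∈-tabulate⁻ j'∈)
      (j≢j' ∘ toE-injective)
      (toV i) (∈-tabulate⁻ i∈j) (∈-tabulate⁻ i∈j')

  independent⁻ : ∀ {Y} → Independent hypergraph Y → PairwiseDisjoint (selectorOf Y)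
  independent⁻ {Y} independent x y x∈ y∈ x≢y c x∋c y∋c =
    independent (fromE x) (fromE y) (lookup⇒[]= _ Y x∈) (lookup⇒[]= _ Y y∈)
      (x≢y ∘ fromE-injective)
      (fromV c , ∈-incidence⁺ x∋c , ∈-incidence⁺ y∋c)

  covers⁺ : ∀ {S i} → Covers S (toV i) → InVX hypergraph (subsetOf S) i
  covers⁺ {S} {i} (x , Sx , x∋c) =
    fromE x , ∈-tabulate⁺ (subst (λ y → S y ≡ true) (sym (toE∘fromE x)) Sx)
            , subst (_∈ₛ incidence (fromE x)) (fromV∘toV i) (∈-incidence⁺ x∋c)

  covers⁻ : ∀ {Y c} → InVX hypergraph Y (fromV c) → Covers (selectorOf Y) c
  covers⁻ {Y} {c} (j , j∈ , c∈j) =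
    toE j , subst (λ j → lookup Y j ≡ true) (sym (fromE∘toE j)) ([]=⇒lookup j∈)
          , subst (λ d → toE j ∋ d ≡ true) (toV∘fromV c) (∈-tabulate⁻ c∈j)

  accepts⁺ : ∀ {α S} → AcceptsBy α S → Accepts program α
  accepts⁺ (disjoint , covers) =
    _ , independent⁺ disjoint , λ i unset → covers⁺ (covers (toV i) unset)

  accepts⁻ : ∀ {α} → Accepts program α → ∃[ S ] AcceptsBy α S
  accepts⁻ {α} (Y , independent , covered) = selectorOf Y , independent⁻ independent , covers
    where
    covers : ∀ c → evalLabel α (ℓ c) ≡ false → Covers (selectorOf Y) c
    covers c unset = covers⁻ (covered (fromV c)
      (subst (λ d → evalLabel α (ℓ d) ≡ false) (sym (toV∘fromV c)) unset))

pattern original v = inj₁ v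
pattern hub e      = inj₂ (inj₁ e)
pattern tag e      = inj₂ (inj₂ e)
pattern extended e = inj₁ e
pattern link e     = inj₂ e

module Extension (H : Hypergraph) where

  open ≤-Reasoning

  Vertex : Set
  Vertex = Fin (nV H) ⊎ (Fin (nE H) ⊎ Fin (nE H))

  Edge : Set
  Edge = Fin (nE H) ⊎ Fin (nE H)

  _∋_ : Edge → Vertex → Bool
  extended e ∋ original v = lookup (edge H e) v
  extended e ∋ hub u      = does (e ≟ u)
  extended e ∋ tag u      = false
  link e     ∋ original v = false
  link e     ∋ hub u      = does (e ≟ u)
  link e     ∋ tag u      = does (e ≟ u)

  ∋-injective : ∀ {x y} → (∀ c → x ∋ c ≡ y ∋ c) → x ≡ y
  ∋-injective {extended e} {extended e'} same
    with refl ← ≟-true⇒≡ e' e (trans (sym (same (hub e))) (does-≟-refl e)) = refl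
  ∋-injective {extended e} {link e'}     same =
    contradiction (trans (same (tag e')) (does-≟-refl e')) λ ()
  ∋-injective {link e}     {extended e'} same =
    contradiction (trans (sym (same (tag e))) (does-≟-refl e)) λ ()
  ∋-injective {link e}     {link e'}     same
    with refl ← ≟-true⇒≡ e' e (trans (sym (same (hub e))) (does-≟-refl e)) = refl

  vertexLabel : Vertex → Label (HVar H)
  vertexLabel (original v) = var (inj₁ v)
  vertexLabel (hub e)      = const false
  vertexLabel (tag e)      = var (inj₂ e)

  vertices : Fin (nV H + (nE H + nE H)) ↔ Vertex
  vertices = ↔-trans +↔⊎ (↔-refl ⊎-↔ +↔⊎)

  open IncidenceProgram vertices +↔⊎ _∋_ ∋-injective vertexLabel public

  monotone : Monotone program
  monotone i x with toV i
  ... | original v = λ ()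
  ... | hub e      = λ ()
  ... | tag e      = λ ()

  degree-≤ : ∀ {n} → DegreeAtMost H n → ∀ c →
    ∣ tabulate (λ e → extended e ∋ c) ∣ + ∣ tabulate (λ e → link e ∋ c) ∣ ≤ 2 ⊔ n
  degree-≤ {n} degH (original v) = begin
    _                    ≡⟨ cong (∣ incident H v ∣ +_) (∣tabulate-false∣ (nE H)) ⟩
    ∣ incident H v ∣ + 0 ≡⟨ +-identityʳ _ ⟩
    ∣ incident H v ∣     ≤⟨ degH v ⟩
    n                    ≤⟨ m≤n⊔m 2 n ⟩
    2 ⊔ n                ∎
  degree-≤ {n} _ (hub u) = begin
    _     ≡⟨ cong₂ _+_ (∣tabulate-≟∣ u) (∣tabulate-≟∣ u) ⟩
    2     ≤⟨ m≤m⊔n 2 n ⟩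
    2 ⊔ n ∎
  degree-≤ {n} _ (tag u) = begin
    _     ≡⟨ cong₂ _+_ (∣tabulate-false∣ (nE H)) (∣tabulate-≟∣ u) ⟩
    1     ≤⟨ ≤-trans (s≤s z≤n) (m≤m⊔n 2 n) ⟩
    2 ⊔ n ∎

  degree : ∀ {n} → DegreeAtMost H n → DegreeAtMost hypergraph (2 ⊔ n)
  degree {n} degH i = begin
    ∣ incident hypergraph i ∣                     ≡⟨ ∣incident∣ i ⟩
    ∣ tabulate (λ j → splitAt (nE H) j ∋ toV i) ∣ ≡⟨ ∣tabulate∘splitAt∣ (nE H) (_∋ toV i) ⟩
    _                                             ≤⟨ degree-≤ degH (toV i) ⟩
    2 ⊔ n                                         ∎

  select : Subset (nE H) → Edge → Bool
  select X (extended e) = lookup X e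
  select X (link e)     = not (lookup X e)

  extended-link-disjoint : ∀ {X e e'} → lookup X e ≡ true → not (lookup X e') ≡ true →
    ∀ c → extended e ∋ c ≡ true → link e' ∋ c ≡ true → ⊥
  extended-link-disjoint {e = e} {e'} e∈ e'∉ (hub u) e≡u e'≡u
    with refl ← ≟-true⇒≡ e u e≡u | refl ← ≟-true⇒≡ e' u e'≡u = not-¬ (sym e∈) (sym e'∉)
  extended-link-disjoint _ _ (original v) _ ()
  extended-link-disjoint _ _ (tag u) () _

  select-disjoint : ∀ {X} → Independent H X → PairwiseDisjoint (select X)
  select-disjoint {X} independent (extended e) (extended e') e∈ e'∈ x≢y (original v) v∈e v∈e' =
    independent e e' (lookup⇒[]= e X e∈) (lookup⇒[]= e' X e'∈) (x≢y ∘ cong inj₁)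
      (v , lookup⇒[]= v (edge H e) v∈e , lookup⇒[]= v (edge H e') v∈e')
  select-disjoint _ (extended e) (extended e') _ _ x≢y (hub u) e≡u e'≡u
    with refl ← ≟-true⇒≡ e u e≡u | refl ← ≟-true⇒≡ e' u e'≡u = x≢y refl
  select-disjoint _ (extended e) (extended e') _ _ _ (tag u) () _
  select-disjoint {X} _ (extended e) (link e') e∈ e'∉ _ c e∋c e'∋c =
    extended-link-disjoint {X} e∈ e'∉ c e∋c e'∋c
  select-disjoint {X} _ (link e) (extended e') e∉ e'∈ _ c e∋c e'∋c =
    extended-link-disjoint {X} e'∈ e∉ c e'∋c e∋c
  select-disjoint _ (link e) (link e') _ _ _ (original v) () _
  select-disjoint _ (link e) (link e') _ _ x≢y (hub u) e≡u e'≡u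
    with refl ← ≟-true⇒≡ e u e≡u | refl ← ≟-true⇒≡ e' u e'≡u = x≢y refl
  select-disjoint _ (link e) (link e') _ _ x≢y (tag u) e≡u e'≡u
    with refl ← ≟-true⇒≡ e u e≡u | refl ← ≟-true⇒≡ e' u e'≡u = x≢y refl

  select-covers : ∀ {α X} →
    (∀ v → ¬ InVX H X v → α (inj₁ v) ≡ true) → (∀ e → e ∈ₛ X → α (inj₂ e) ≡ true) →
    ∀ c → evalLabel α (vertexLabel c) ≡ false → Covers (select X) c
  select-covers {X = X} uncovered _ (original v) unset
    with any? (λ e → e ∈? X ×-dec v ∈? edge H e)
  ... | yes (e , e∈X , v∈e) = extended e , []=⇒lookup e∈X , []=⇒lookup v∈e
  ... | no v∉VX = contradiction (trans (sym (uncovered v v∉VX)) unset) λ ()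
  select-covers {X = X} _ _ (hub u) _ with lookup X u in u∈?
  ... | true  = extended u , u∈? , does-≟-refl u
  ... | false = link u , cong not u∈? , does-≟-refl u
  select-covers {X = X} _ chosen (tag u) unset with lookup X u in u∈?
  ... | true  = contradiction (trans (sym (chosen u (lookup⇒[]= u X u∈?))) unset) λ ()
  ... | false = link u , cong not u∈? , does-≟-refl u

  fH-of-acceptsBy : ∀ {α S} → AcceptsBy α S → fH H α
  fH-of-acceptsBy {α} {S} (disjoint , covers) = X , independent , uncovered , chosen
    where
    X : Subset (nE H)
    X = tabulate (S ∘ extended)

    independent : Independent H X
    independent e e' e∈ e'∈ e≢e' (v , v∈e , v∈e') =
      disjoint (extended e) (extended e') (∈-tabulate⁻ e∈) (∈-tabulate⁻ e'∈)
        (λ { refl → e≢e' refl }) (original v) ([]=⇒lookup v∈e) ([]=⇒lookup v∈e')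

    uncovered : ∀ v → ¬ InVX H X v → α (inj₁ v) ≡ true
    uncovered v v∉VX with α (inj₁ v) in αv
    ... | true  = refl
    ... | false with covers (original v) αv
    ... | extended e , Se , e∋v =
      contradiction (e , ∈-tabulate⁺ Se , lookup⇒[]= v (edge H e) e∋v) v∉VX

    chosen : ∀ e → e ∈ₛ X → α (inj₂ e) ≡ true
    chosen e e∈X with α (inj₂ e) in αe
    ... | true  = refl
    ... | false with covers (tag e) αe
    ... | link e' , Se' , e'≡e with refl ← ≟-true⇒≡ e' e e'≡e =
      ⊥-elim (disjoint (extended e) (link e) (∈-tabulate⁻ e∈X) Se' (λ ())
                        (hub e) (does-≟-refl e) (does-≟-refl e))

  computes : Computes program (fH H)
  computes α = mk⇔
    (λ (X , independent , uncovered , chosen) →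
      accepts⁺ (select-disjoint independent , select-covers uncovered chosen))
    (fH-of-acceptsBy ∘ proj₂ ∘ accepts⁻)

lemma4 : (n : ℕ) (H : Hypergraph) → DegreeAtMost H n →
    ∃[ P ] (Monotone {HVar H} P
    × DegreeAtMost (graph P) (2 ⊔ n)
    × size (graph P) ≡ 2 * size H
    × Computes P (fH H))
lemma4 n H degH =
  program , monotone , degree degH , cong (nE H +_) (sym (+-identityʳ (nE H))) , computes
  where open Extension H
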